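{- Let $\sigma$ be the morphism on $\{0,1,2\}^*$ defined by $\sigma(0)=01$, $\sigma(1)=12$, $\sigma(2)=20$, let $\mathbf{t}=\sigma^{\infty}(0)$ be its fixed point starting with $0$, let $\tau_1$ be the morphism with $\tau_1(0)=2$, $\tau_1(1)=1$, $\tau_1(2)=0$, and let the words $W(n)$, $n\geq1$, be as defined in the context. Then for all $n\geq 1$, both $W(n)$ and $\tau_1(W(n))^R$ are factors of $\mathbf{t}$, and \[\mathrm{DS}(W(n))=n+\lfloor \log_2 n\rfloor+1,\qquad \mathrm{DS}(\tau_1(W(n))^R)=n-\lfloor \log_2 n\rfloor-1.\]
   Context: $\mathrm{DS}(u)$ is the sum of the letters of $u$ (viewed as integers); $w^R$ is the mirror (reversal) of $w$. Letters $d_k$ ($k\geq -1$): $d_k=0$ if $k\equiv 3,4\pmod 6$, $d_k=1$ if $k\equiv1,2\pmod6$, $d_k=2$ if $k\equiv 0,5\pmod 6$. Words $W(n)$: $W(1)=2$. For $n\geq2$, let $k\geq1$ with $2^k\leq n<2^{k+1}$ and write $n-2^k=\sum_{j=0}^{k-1}m_j2^j$ with $m_j\in\{0,1\}$. Let $\delta=\varepsilon$ (empty word) if $m_0=0$ and $\delta=1$ if $m_0=1$. Let $L=\lfloor (k-1)/2\rfloor$ and $R=\lceil (k-1)/2\rceil$. Define $W_L(n)=\delta\,2\,\sigma^{2+m_2}(d_{2+m_2})\,\sigma^{4+m_4}(d_{4+m_4})\cdots\sigma^{2L+m_{2L}}(d_{2L+m_{2L}})$ (factors in increasing order of $i=1,\dots,L$,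 empty product if $L=0$) and $W_R(n)=\sigma^{2R-1+m_{2R-1}}(d_{2R-1+m_{2R-1}})\cdots\sigma^{3+m_3}(d_{3+m_3})\,\sigma^{1+m_1}(d_{1+m_1})\,2$ (factors in decreasing order of $i=R,\dots,1$, empty product if $R=0$), and $W(n)=W_L(n)W_R(n)$. -}

module Defs where

open import Data.Nat using (ℕ; zero; suc; _+_; _*_; _∸_; _^_; ⌊_/2⌋; ⌈_/2⌉)
open import Data.Nat.DivMod using (_%_)
open import Data.Nat.Logarithm using (⌊log₂_⌋)
open import Data.Fin using (Fin; toℕ) renaming (zero to f0; suc to fs)
open import Data.List using (List; []; _∷_; _++_; map; concat; concatMap; reverse; upTo; length)
open import Data.Nat.ListAction using (sum)
open import Data.Product using (∃; _×_)
open import Relation.Binary.PropositionalEquality using (_≡_)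

Letter : Set
Letter = Fin 3

l0 l1 l2 : Letter
l0 = f0
l1 = fs f0
l2 = fs (fs f0)

Word : Set
Word = List Letter

σ₁ : Letter → Word
σ₁ f0 = l0 ∷ l1 ∷ []
σ₁ (fs f0) = l1 ∷ l2 ∷ []
σ₁ (fs (fs f0)) = l2 ∷ l0 ∷ []

σ : Word → Word
σ = concatMap σ₁

σ^ : ℕ → Word → Word
σ^ zero w = w
σ^ (suc k) w = σ (σ^ k w)

τ₁₁ : Letter → Letter
τ₁₁ f0 = l2
τ₁₁ (fs f0) = l1
τ₁₁ (fs (fs f0)) = l0

τ₁ : Word → Word
τ₁ = map τ₁₁

mirror : Word → Word
mirror = reverse

DS : Word → ℕ
DS u = sum (map toℕ u)

-- i-th letter of a finite word (default 0 out of range)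
nth : Word → ℕ → Letter
nth [] _ = l0
nth (a ∷ w) zero = a
nth (a ∷ w) (suc i) = nth w i

-- The fixed point t = σ^∞(0): since σ(0) starts with 0, σ^k(0) is a prefix
-- of σ^(k+1)(0) of length 2^k; letter i of t is letter i of σ^(i+1)(0)
-- (which has length 2^(i+1) > i).
t : ℕ → Letter
t i = nth (σ^ (suc i) (l0 ∷ [])) i

slice : (ℕ → Letter) → ℕ → ℕ → Word
slice x i ℓ = map (λ j → x (i + j)) (upTo ℓ)

FactorOfT : Word → Set
FactorOfT w = ∃ λ i → slice t i (length w) ≡ w

-- d_k (only k ≥ 1 occurs in W(n))
d : ℕ → Letter
d k with k % 6
... | 0 = l2
... | 1 = l1
... | 2 = l1
... | 3 = l0
... | 4 = l0
... | _ = l2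

shiftR : ℕ → ℕ → ℕ
shiftR zero x = x
shiftR (suc j) x = shiftR j ⌊ x /2⌋

bit : ℕ → ℕ → ℕ
bit j x = shiftR j x % 2

module _ (n : ℕ) where
  kk : ℕ
  kk = ⌊log₂ n ⌋

  m : ℕ → ℕ
  m j = bit j (n ∸ 2 ^ kk)

  δ : Word
  δ with m 0
  ... | 0 = []
  ... | _ = l1 ∷ []

  Lc Rc : ℕ
  Lc = ⌊ kk ∸ 1 /2⌋
  Rc = ⌈ kk ∸ 1 /2⌉

  blockL : ℕ → Word
  blockL i = σ^ (2 * i + m (2 * i)) (d (2 * i + m (2 * i)) ∷ [])

  blockR : ℕ → Word
  blockR i = σ^ (2 * i ∸ 1 + m (2 * i ∸ 1)) (d (2 * i ∸ 1 + m (2 * i ∸ 1)) ∷ [])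

  W-L : Word
  W-L = δ ++ (l2 ∷ concat (map (λ i → blockL (suc i)) (upTo Lc)))

  W-R : Word
  W-R = concat (reverse (map (λ i → blockR (suc i)) (upTo Rc))) ++ (l2 ∷ [])

W : ℕ → Word
W zero = []                 -- unused (n ≥ 1)
W (suc zero) = l2 ∷ []
W n@(suc (suc _)) = W-L n ++ W-R n

-- Writing letters as residues modulo 3, σ(a) = a (a+1), so t(2i) = t(i) and
-- t(2i+1) = t(i) + 1.  Hence the block of t of length 2^e at position q·2^e is
-- σ^e(t(q)) (block-occurs), and t(j) + t(2^h-1-j) ≡ h (mod 3) (t-complement);
-- choosing h ≡ 2 shows that factors are closed under w ↦ τ₁(w)^R (mirror-factor).
-- W(n) is a concatenation of blocks σ^e(d_e) and a few single letters.  For an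
-- arbitrary sequence of binary digits (module Construction) the left part is placed
-- block by block ending at a suitable odd multiple of a power of 2, the right part
-- starting there (right-occurs, left-occurs); the only constraint is a congruence
-- modulo 3 relating t at the junction to d_e, which d_k ≡ 2 - ⌈k/2⌉ makes consistent.
-- Each block has digit sum 2^e + 1 (DS-block), so DS(W) = |W| + k + 1, and summing
-- the block lengths 2^(j + m_j) gives |W(n)| = 2^k + (n - 2^k) = n.  Finally
-- DS(τ₁(w)^R) = 2|w| - DS(w).
module Submission where

open import Data.Nat
open import Data.Nat.Properties
open import Data.Nat.DivMod using (_%_; m%n<n)
open import Data.Nat.Logarithm
open import Data.Fin using (toℕ) renaming (zero to f0; suc to fs)
open import Data.List using (List; []; _∷_; _++_; map; concat; reverse; upTo; applyUpTo; length)
open import Data.List.Properties using (length-++; length-map; length-reverse; map-++; ++-assoc; ++-identityʳ; concat-++; reverse-++; map-upTo; upTo-∷ʳ; unfold-reverse)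
open import Relation.Nullary using (contradiction)
open import Data.Product using (∃; _×_; _,_; proj₁; proj₂)
open import Data.Sum using (_⊎_; inj₁; inj₂)
open import Relation.Binary.PropositionalEquality
open import Function using (_∘_)
open import Data.Nat.Tactic.RingSolver using (solve-∀)
open import Data.Nat.ListAction using (sum)
open import Data.Nat.ListAction.Properties using (sum-++)

open import Defs

-- successor modulo 3; σ sends a letter a to the word a (inc a)
inc : Letter → Letter
inc f0 = l1
inc (fs f0) = l2
inc (fs (fs f0)) = l0

_⊕_ : Letter → Letter → Letter
x ⊕ f0 = x
x ⊕ fs f0 = inc x
x ⊕ fs (fs f0) = inc (inc x)

infixl 6 _⊕_

neg : Letter → Letter
neg f0 = l0
neg (fs f0) = l2
neg (fs (fs f0)) = l1

c : ℕ → Letter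
c zero = l0
c (suc n) = inc (c n)

inc³ : ∀ x → inc (inc (inc x)) ≡ x
inc³ f0 = refl
inc³ (fs f0) = refl
inc³ (fs (fs f0)) = refl

inc-injective : ∀ {x y} → inc x ≡ inc y → x ≡ y
inc-injective {x} {y} p = trans (sym (inc³ x)) (trans (cong (inc ∘ inc) p) (inc³ y))

⊕-identityˡ : ∀ y → l0 ⊕ y ≡ y
⊕-identityˡ f0 = refl
⊕-identityˡ (fs f0) = refl
⊕-identityˡ (fs (fs f0)) = refl

inc-⊕ : ∀ x y → inc x ⊕ y ≡ inc (x ⊕ y)
inc-⊕ x f0 = refl
inc-⊕ x (fs f0) = refl
inc-⊕ x (fs (fs f0)) = refl

⊕-inc : ∀ x y → x ⊕ inc y ≡ inc (x ⊕ y)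
⊕-inc x f0 = refl
⊕-inc x (fs f0) = refl
⊕-inc x (fs (fs f0)) = sym (inc³ x)

⊕-comm : ∀ x y → x ⊕ y ≡ y ⊕ x
⊕-comm x f0 = sym (⊕-identityˡ x)
⊕-comm x (fs f0) = trans (cong inc (sym (⊕-identityˡ x))) (sym (inc-⊕ l0 x))
⊕-comm x (fs (fs f0)) =
  trans (cong (λ z → inc (inc z)) (sym (⊕-identityˡ x)))
        (sym (trans (inc-⊕ l1 x) (cong inc (inc-⊕ l0 x))))

⊕-assoc : ∀ x y z → x ⊕ y ⊕ z ≡ x ⊕ (y ⊕ z)
⊕-assoc x y f0 = refl
⊕-assoc x y (fs f0) = sym (⊕-inc x y)
⊕-assoc x y (fs (fs f0)) = trans (cong inc (sym (⊕-inc x y))) (sym (⊕-inc x (inc y)))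

⊕-cancelʳ : ∀ {x y} z → x ⊕ z ≡ y ⊕ z → x ≡ y
⊕-cancelʳ f0 p = p
⊕-cancelʳ (fs f0) p = inc-injective p
⊕-cancelʳ (fs (fs f0)) p = inc-injective (inc-injective p)

⊕-inverseʳ : ∀ x → x ⊕ neg x ≡ l0
⊕-inverseʳ f0 = refl
⊕-inverseʳ (fs f0) = refl
⊕-inverseʳ (fs (fs f0)) = refl

⊕-solve : ∀ x z → z ⊕ neg x ⊕ x ≡ z
⊕-solve x z = begin
  z ⊕ neg x ⊕ x   ≡⟨ ⊕-assoc z (neg x) x ⟩
  z ⊕ (neg x ⊕ x) ≡⟨ cong (z ⊕_) (trans (⊕-comm (neg x) x) (⊕-inverseʳ x)) ⟩
  z               ∎
  where open ≡-Reasoning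

c-+ : ∀ a b → c (a + b) ≡ c a ⊕ c b
c-+ zero b = sym (⊕-identityˡ (c b))
c-+ (suc a) b = trans (cong inc (c-+ a b)) (sym (inc-⊕ (c a) (c b)))

c-3* : ∀ m → c (3 * m) ≡ l0
c-3* zero = refl
c-3* (suc m) = trans (cong c (*-suc 3 m)) (cong (λ z → inc (inc (inc z))) (c-3* m))

c-toℕ : ∀ a → c (toℕ a) ≡ a
c-toℕ f0 = refl
c-toℕ (fs f0) = refl
c-toℕ (fs (fs f0)) = refl

c-unbounded : ∀ B a → ∃ λ G → B ≤ G × c G ≡ a
c-unbounded B a = 3 * B + toℕ a , ≤-trans (m≤m+n B _) (m≤m+n (3 * B) (toℕ a)) ,
  trans (c-+ (3 * B) (toℕ a)) (trans (cong₂ _⊕_ (c-3* B) (c-toℕ a)) (⊕-identityˡ a))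

τ₁₁-complement : ∀ x → τ₁₁ x ⊕ x ≡ l2
τ₁₁-complement f0 = refl
τ₁₁-complement (fs f0) = refl
τ₁₁-complement (fs (fs f0)) = refl

τ₁₁-unique : ∀ x y → x ⊕ y ≡ l2 → y ≡ τ₁₁ x
τ₁₁-unique x y p = ⊕-cancelʳ x (trans (⊕-comm y x) (trans p (sym (τ₁₁-complement x))))

σ-cons : ∀ a w → σ (a ∷ w) ≡ a ∷ inc a ∷ σ w
σ-cons f0 w = refl
σ-cons (fs f0) w = refl
σ-cons (fs (fs f0)) w = refl

σ-++ : ∀ v w → σ (v ++ w) ≡ σ v ++ σ w
σ-++ [] w = refl
σ-++ (a ∷ v) w = begin
  σ (a ∷ v ++ w)             ≡⟨ σ-cons a (v ++ w) ⟩
  a ∷ inc a ∷ σ (v ++ w)     ≡⟨ cong (λ z → a ∷ inc a ∷ z) (σ-++ v w) ⟩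
  a ∷ inc a ∷ (σ v ++ σ w)   ≡⟨ cong (_++ σ w) (sym (σ-cons a v)) ⟩
  σ (a ∷ v) ++ σ w           ∎
  where open ≡-Reasoning

σ^-++ : ∀ e v w → σ^ e (v ++ w) ≡ σ^ e v ++ σ^ e w
σ^-++ zero v w = refl
σ^-++ (suc e) v w = trans (cong σ (σ^-++ e v w)) (σ-++ (σ^ e v) (σ^ e w))

σ^-σ : ∀ e w → σ^ e (σ w) ≡ σ (σ^ e w)
σ^-σ zero w = refl
σ^-σ (suc e) w = cong σ (σ^-σ e w)

-- σ^(e+1)(a) = σ^e(a) σ^e(a+1): the recursion behind every block of t
σ^-suc : ∀ e a → σ^ (suc e) (a ∷ []) ≡ σ^ e (a ∷ []) ++ σ^ e (inc a ∷ [])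
σ^-suc e a = begin
  σ (σ^ e (a ∷ []))                     ≡⟨ sym (σ^-σ e (a ∷ [])) ⟩
  σ^ e (σ (a ∷ []))                     ≡⟨ cong (σ^ e) (σ-cons a []) ⟩
  σ^ e ((a ∷ []) ++ (inc a ∷ []))       ≡⟨ σ^-++ e (a ∷ []) (inc a ∷ []) ⟩
  σ^ e (a ∷ []) ++ σ^ e (inc a ∷ [])    ∎
  where open ≡-Reasoning

length-σ^ : ∀ e a → length (σ^ e (a ∷ [])) ≡ 2 ^ e
length-σ^ zero a = refl
length-σ^ (suc e) a = begin
  length (σ^ (suc e) (a ∷ []))                           ≡⟨ cong length (σ^-suc e a) ⟩
  length (σ^ e (a ∷ []) ++ σ^ e (inc a ∷ []))            ≡⟨ length-++ (σ^ e (a ∷ [])) ⟩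
  length (σ^ e (a ∷ [])) + length (σ^ e (inc a ∷ []))    ≡⟨ cong₂ _+_ (length-σ^ e a) (length-σ^ e (inc a)) ⟩
  2 ^ e + 2 ^ e                                          ≡⟨ cong (2 ^ e +_) (sym (+-identityʳ (2 ^ e))) ⟩
  2 ^ suc e                                              ∎
  where open ≡-Reasoning

nth-σ-even : ∀ w i → nth (σ w) (2 * i) ≡ nth w i
nth-σ-even [] i = refl
nth-σ-even (a ∷ w) zero rewrite σ-cons a w = refl
nth-σ-even (a ∷ w) (suc i) = begin
  nth (σ (a ∷ w)) (2 * suc i)           ≡⟨ cong (nth (σ (a ∷ w))) (*-suc 2 i) ⟩
  nth (σ (a ∷ w)) (2 + 2 * i)           ≡⟨ cong (λ v → nth v (2 + 2 * i)) (σ-cons a w) ⟩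
  nth (σ w) (2 * i)                     ≡⟨ nth-σ-even w i ⟩
  nth w i                               ∎
  where open ≡-Reasoning

nth-σ-odd : ∀ w i → i < length w → nth (σ w) (suc (2 * i)) ≡ inc (nth w i)
nth-σ-odd (a ∷ w) zero _ rewrite σ-cons a w = refl
nth-σ-odd (a ∷ w) (suc i) (s≤s i<) = begin
  nth (σ (a ∷ w)) (suc (2 * suc i))     ≡⟨ cong (nth (σ (a ∷ w)) ∘ suc) (*-suc 2 i) ⟩
  nth (σ (a ∷ w)) (3 + 2 * i)           ≡⟨ cong (λ v → nth v (3 + 2 * i)) (σ-cons a w) ⟩
  nth (σ w) (suc (2 * i))               ≡⟨ nth-σ-odd w i i< ⟩
  inc (nth w i)                         ∎
  where open ≡-Reasoning

nth-++ : ∀ v w i → i < length v → nth (v ++ w) i ≡ nth v i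
nth-++ (a ∷ v) w zero _ = refl
nth-++ (a ∷ v) w (suc i) (s≤s i<) = nth-++ v w i i<

u : ℕ → Word
u a = σ^ a (l0 ∷ [])

n<2^n : ∀ n → n < 2 ^ n
n<2^n zero = s≤s z≤n
n<2^n (suc n) = begin-strict
  suc n           <⟨ s≤s (n<2^n n) ⟩
  1 + 2 ^ n       ≤⟨ +-monoˡ-≤ (2 ^ n) (m^n>0 2 n) ⟩
  2 ^ n + 2 ^ n   ≡⟨ cong (2 ^ n +_) (sym (+-identityʳ (2 ^ n))) ⟩
  2 ^ suc n       ∎
  where open ≤-Reasoning

nth-u-stable : ∀ a b i → i < 2 ^ a → nth (u (b + a)) i ≡ nth (u a) i
nth-u-stable a zero i i< = refl
nth-u-stable a (suc b) i i< = begin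
  nth (u (suc b + a)) i                                ≡⟨ cong (λ w → nth w i) (σ^-suc (b + a) l0) ⟩
  nth (u (b + a) ++ σ^ (b + a) (l1 ∷ [])) i            ≡⟨ nth-++ (u (b + a)) _ i i<len ⟩
  nth (u (b + a)) i                                    ≡⟨ nth-u-stable a b i i< ⟩
  nth (u a) i                                          ∎
  where
  open ≡-Reasoning
  i<len : i < length (u (b + a))
  i<len = <-≤-trans i< (≤-trans (^-monoʳ-≤ 2 (m≤n+m a b)) (≤-reflexive (sym (length-σ^ (b + a) l0))))

nth-u≡t : ∀ a i → i < 2 ^ a → nth (u a) i ≡ t i
nth-u≡t a i i< with ≤-total a (suc i)
... | inj₁ a≤ = begin
  nth (u a) i                       ≡⟨ sym (nth-u-stable a (suc i ∸ a) i i<) ⟩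
  nth (u (suc i ∸ a + a)) i         ≡⟨ cong (λ z → nth (u z) i) (m∸n+n≡m a≤) ⟩
  t i                               ∎
  where open ≡-Reasoning
... | inj₂ ≤a = begin
  nth (u a) i                       ≡⟨ cong (λ z → nth (u z) i) (sym (m∸n+n≡m ≤a)) ⟩
  nth (u (a ∸ suc i + suc i)) i     ≡⟨ nth-u-stable (suc i) (a ∸ suc i) i (<-trans (n<1+n i) (n<2^n (suc i))) ⟩
  t i                               ∎
  where open ≡-Reasoning

odd<2^ : ∀ i → suc (2 * i) < 2 ^ suc (suc i)
odd<2^ i = begin-strict
  suc (2 * i)        <⟨ n<1+n (suc (2 * i)) ⟩
  2 + 2 * i          ≡⟨ sym (*-suc 2 i) ⟩
  2 * suc i          ≤⟨ *-monoʳ-≤ 2 (<⇒≤ (n<2^n (suc i))) ⟩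
  2 ^ suc (suc i)    ∎
  where open ≤-Reasoning

t-even : ∀ i → t (2 * i) ≡ t i
t-even i = begin
  t (2 * i)                        ≡⟨ sym (nth-u≡t (suc (suc i)) (2 * i) (<-trans (n<1+n (2 * i)) (odd<2^ i))) ⟩
  nth (σ (u (suc i))) (2 * i)      ≡⟨ nth-σ-even (u (suc i)) i ⟩
  t i                              ∎
  where open ≡-Reasoning

t-odd : ∀ i → t (suc (2 * i)) ≡ inc (t i)
t-odd i = begin
  t (suc (2 * i))                        ≡⟨ sym (nth-u≡t (suc (suc i)) (suc (2 * i)) (odd<2^ i)) ⟩
  nth (σ (u (suc i))) (suc (2 * i))      ≡⟨ nth-σ-odd (u (suc i)) i i<len ⟩
  inc (t i)                              ∎
  where
  open ≡-Reasoning
  i<len : i < length (u (suc i))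
  i<len = <-≤-trans (<-trans (n<1+n i) (n<2^n (suc i))) (≤-reflexive (sym (length-σ^ (suc i) l0)))

t-*2^ : ∀ q e → t (q * 2 ^ e) ≡ t q
t-*2^ q zero = cong t (*-identityʳ q)
t-*2^ q (suc e) = begin
  t (q * 2 ^ suc e)      ≡⟨ cong t (trans (*-comm q (2 ^ suc e)) (*-assoc 2 (2 ^ e) q)) ⟩
  t (2 * (2 ^ e * q))    ≡⟨ t-even (2 ^ e * q) ⟩
  t (2 ^ e * q)          ≡⟨ cong t (*-comm (2 ^ e) q) ⟩
  t (q * 2 ^ e)          ≡⟨ t-*2^ q e ⟩
  t q                    ∎
  where open ≡-Reasoning

window : ℕ → ℕ → Word
window x zero = []
window x (suc ℓ) = t x ∷ window (suc x) ℓ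

slice≡window : ∀ x ℓ → slice t x ℓ ≡ window x ℓ
slice≡window x ℓ = trans (map-upTo (λ j → t (x + j)) ℓ) (tabulated (λ j → t (x + j)) x ℓ (λ j → refl))
  where
  tabulated : ∀ (h : ℕ → Letter) x ℓ → (∀ j → h j ≡ t (x + j)) → applyUpTo h ℓ ≡ window x ℓ
  tabulated h x zero _ = refl
  tabulated h x (suc ℓ) h≗ = cong₂ _∷_ (trans (h≗ 0) (cong t (+-identityʳ x)))
    (tabulated (h ∘ suc) (suc x) ℓ (λ j → trans (h≗ (suc j)) (cong t (+-suc x j))))

window-++ : ∀ x a b → window x (a + b) ≡ window x a ++ window (x + a) b
window-++ x zero b = cong (λ z → window z b) (sym (+-identityʳ x))
window-++ x (suc a) b = cong (t x ∷_) (trans (window-++ (suc x) a b) (cong (λ z → window (suc x) a ++ window z b) (sym (+-suc x a))))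

OccursAt : Word → ℕ → Set
OccursAt w P = window P (length w) ≡ w

occurs⇒factor : ∀ {w} P → OccursAt w P → FactorOfT w
occurs⇒factor {w} P occ = P , trans (slice≡window P (length w)) occ

occurs-++ : ∀ {v w P} → OccursAt v P → OccursAt w (P + length v) → OccursAt (v ++ w) P
occurs-++ {v} {w} {P} occV occW = begin
  window P (length (v ++ w))                         ≡⟨ cong (window P) (length-++ v) ⟩
  window P (length v + length w)                     ≡⟨ window-++ P (length v) (length w) ⟩
  window P (length v) ++ window (P + length v) (length w) ≡⟨ cong₂ _++_ occV occW ⟩
  v ++ w                                             ∎
  where open ≡-Reasoning

block-occurs : ∀ e q → OccursAt (σ^ e (t q ∷ [])) (q * 2 ^ e)
block-occurs zero q = cong (λ z → t z ∷ []) (*-identityʳ q)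
block-occurs (suc e) q =
  subst (λ w → OccursAt w (q * 2 ^ suc e)) (sym (σ^-suc e (t q))) (occurs-++ left right)
  where
  even-pos : ∀ q x → 2 * q * x ≡ q * (2 * x)
  even-pos = solve-∀
  odd-pos : ∀ q x → suc (2 * q) * x ≡ q * (2 * x) + x
  odd-pos = solve-∀
  left : OccursAt (σ^ e (t q ∷ [])) (q * 2 ^ suc e)
  left = subst₂ (λ a P → OccursAt (σ^ e (a ∷ [])) P) (t-even q) (even-pos q (2 ^ e)) (block-occurs e (2 * q))
  right : OccursAt (σ^ e (inc (t q) ∷ [])) (q * 2 ^ suc e + length (σ^ e (t q ∷ [])))
  right = subst₂ (λ a P → OccursAt (σ^ e (a ∷ [])) P) (t-odd q)
    (trans (odd-pos q (2 ^ e)) (cong (q * 2 ^ suc e +_) (sym (length-σ^ e (t q)))))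
    (block-occurs e (suc (2 * q)))

data ParityView : ℕ → Set where
  even : ∀ j → ParityView (2 * j)
  odd  : ∀ j → ParityView (suc (2 * j))

parityView : ∀ i → ParityView i
parityView zero = even 0
parityView (suc i) with parityView i
... | even j = odd j
... | odd j = subst ParityView (*-suc 2 j) (even (suc j))

t-complement : ∀ h j k → suc (j + k) ≡ 2 ^ h → t j ⊕ t k ≡ c h
t-complement zero zero zero _ = refl
t-complement zero zero (suc k) ()
t-complement zero (suc j) k ()
t-complement (suc h) j k sum≡ with parityView j | parityView k
... | even a | even b = contradiction (trans (sym sum≡) (cong suc (ee a b))) (even≢odd (2 ^ h) (a + b))
  where
  ee : ∀ a b → 2 * a + 2 * b ≡ 2 * (a + b)
  ee = solve-∀
... | odd a | odd b = contradiction (trans (sym sum≡) (oo a b)) (even≢odd (2 ^ h) (suc (a + b)))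
  where
  oo : ∀ a b → suc (suc (2 * a) + suc (2 * b)) ≡ suc (2 * suc (a + b))
  oo = solve-∀
... | even a | odd b = begin
  t (2 * a) ⊕ t (suc (2 * b))   ≡⟨ cong₂ _⊕_ (t-even a) (t-odd b) ⟩
  t a ⊕ inc (t b)               ≡⟨ ⊕-inc (t a) (t b) ⟩
  inc (t a ⊕ t b)               ≡⟨ cong inc (t-complement h a b (*-cancelˡ-≡ (suc (a + b)) (2 ^ h) 2 (trans (sym (eo a b)) sum≡))) ⟩
  c (suc h)                     ∎
  where
  open ≡-Reasoning
  eo : ∀ a b → suc (2 * a + suc (2 * b)) ≡ 2 * suc (a + b)
  eo = solve-∀
... | odd a | even b = begin
  t (suc (2 * a)) ⊕ t (2 * b)   ≡⟨ cong₂ _⊕_ (t-odd a) (t-even b) ⟩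
  inc (t a) ⊕ t b               ≡⟨ inc-⊕ (t a) (t b) ⟩
  inc (t a ⊕ t b)               ≡⟨ cong inc (t-complement h a b (*-cancelˡ-≡ (suc (a + b)) (2 ^ h) 2 (trans (sym (oe a b)) sum≡))) ⟩
  c (suc h)                     ∎
  where
  open ≡-Reasoning
  oe : ∀ a b → suc (suc (2 * a) + 2 * b) ≡ 2 * suc (a + b)
  oe = solve-∀

window-mirror : ∀ h → c h ≡ l2 → ∀ ℓ P P' → P' + ℓ + P ≡ 2 ^ h →
                window P' ℓ ≡ mirror (τ₁ (window P ℓ))
window-mirror h ch zero P P' _ = refl
window-mirror h ch (suc ℓ) P P' pos = begin
  window P' (suc ℓ)                                 ≡⟨ cong (window P') (+-comm 1 ℓ) ⟩
  window P' (ℓ + 1)                                 ≡⟨ window-++ P' ℓ 1 ⟩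
  window P' ℓ ++ (t (P' + ℓ) ∷ [])                  ≡⟨ cong₂ (λ v a → v ++ (a ∷ [])) (window-mirror h ch ℓ (suc P) P' pos′) last ⟩
  mirror (τ₁ (window (suc P) ℓ)) ++ (τ₁₁ (t P) ∷ []) ≡⟨ sym (unfold-reverse (τ₁₁ (t P)) (τ₁ (window (suc P) ℓ))) ⟩
  mirror (τ₁ (window P (suc ℓ)))                    ∎
  where
  open ≡-Reasoning
  pos′ : P' + ℓ + suc P ≡ 2 ^ h
  pos′ = trans (+-suc (P' + ℓ) P) (trans (cong (_+ P) (sym (+-suc P' ℓ))) pos)
  last : t (P' + ℓ) ≡ τ₁₁ (t P)
  last = τ₁₁-unique (t P) (t (P' + ℓ))
    (trans (t-complement h P (P' + ℓ) (trans (cong suc (+-comm P (P' + ℓ))) (trans (sym (+-suc (P' + ℓ) P)) pos′))) ch)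

mirror-factor : ∀ w → FactorOfT w → FactorOfT (mirror (τ₁ w))
mirror-factor w (P , occ) = occurs⇒factor P' (begin
  window P' (length (mirror (τ₁ w)))    ≡⟨ cong (window P') (trans (length-reverse (τ₁ w)) (length-map τ₁₁ w)) ⟩
  window P' ℓ                           ≡⟨ window-mirror h ch ℓ P P' P'+ℓ+P ⟩
  mirror (τ₁ (window P ℓ))              ≡⟨ cong (mirror ∘ τ₁) (trans (sym (slice≡window P ℓ)) occ) ⟩
  mirror (τ₁ w)                         ∎)
  where
  open ≡-Reasoning
  ℓ = length w
  h = 3 * (P + ℓ) + 2
  ch : c h ≡ l2
  ch = trans (c-+ (3 * (P + ℓ)) 2) (cong (_⊕ l2) (c-3* (P + ℓ)))
  P+ℓ≤2^h : P + ℓ ≤ 2 ^ h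
  P+ℓ≤2^h = <⇒≤ (≤-<-trans (≤-trans (m≤n*m (P + ℓ) 3) (m≤m+n (3 * (P + ℓ)) 2)) (n<2^n h))
  P' = 2 ^ h ∸ (P + ℓ)
  P'+ℓ+P : P' + ℓ + P ≡ 2 ^ h
  P'+ℓ+P = trans (+-assoc P' ℓ P) (trans (cong (P' +_) (+-comm ℓ P)) (m∸n+n≡m P+ℓ≤2^h))

DS-++ : ∀ v w → DS (v ++ w) ≡ DS v + DS w
DS-++ v w = trans (cong sum (map-++ toℕ v w)) (sum-++ (map toℕ v) (map toℕ w))

DS-reverse : ∀ w → DS (reverse w) ≡ DS w
DS-reverse [] = refl
DS-reverse (a ∷ w) = begin
  DS (reverse (a ∷ w))        ≡⟨ cong DS (unfold-reverse a w) ⟩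
  DS (reverse w ++ (a ∷ []))  ≡⟨ DS-++ (reverse w) (a ∷ []) ⟩
  DS (reverse w) + (toℕ a + 0) ≡⟨ cong₂ _+_ (DS-reverse w) (+-identityʳ (toℕ a)) ⟩
  DS w + toℕ a                ≡⟨ +-comm (DS w) (toℕ a) ⟩
  DS (a ∷ w)                  ∎
  where open ≡-Reasoning

-- each letter x contributes 2 to DS(τ₁ w) + DS(w)
DS-τ₁ : ∀ w → DS (τ₁ w) + DS w ≡ 2 * length w
DS-τ₁ [] = refl
DS-τ₁ (a ∷ w) = begin
  (toℕ (τ₁₁ a) + DS (τ₁ w)) + (toℕ a + DS w)   ≡⟨ swap (toℕ (τ₁₁ a)) (DS (τ₁ w)) (toℕ a) (DS w) ⟩
  (toℕ (τ₁₁ a) + toℕ a) + (DS (τ₁ w) + DS w)   ≡⟨ cong₂ _+_ (letter a) (DS-τ₁ w) ⟩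
  2 + 2 * length w                             ≡⟨ sym (*-suc 2 (length w)) ⟩
  2 * length (a ∷ w)                           ∎
  where
  open ≡-Reasoning
  swap : ∀ x y z v → x + y + (z + v) ≡ x + z + (y + v)
  swap = solve-∀
  letter : ∀ a → toℕ (τ₁₁ a) + toℕ a ≡ 2
  letter f0 = refl
  letter (fs f0) = refl
  letter (fs (fs f0)) = refl

DS-mirror-τ₁ : ∀ w → DS (mirror (τ₁ w)) + DS w ≡ 2 * length w
DS-mirror-τ₁ w = trans (cong (_+ DS w) (DS-reverse (τ₁ w))) (DS-τ₁ w)

-- Digit sums of the blocks σ^e(a).  Writing DS(σ^e(a)) + 1 = 2^e + offset e a,
-- the offset is 6-periodic in e and obeys the recursion of σ^-suc.

offset : ℕ → Letter → ℕ
offset 0 a = toℕ a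
offset 1 f0 = 0
offset 1 (fs f0) = 2
offset 1 (fs (fs f0)) = 1
offset 2 f0 = 1
offset 2 (fs f0) = 2
offset 2 (fs (fs f0)) = 0
offset 3 f0 = 2
offset 3 (fs f0) = 1
offset 3 (fs (fs f0)) = 0
offset 4 f0 = 2
offset 4 (fs f0) = 0
offset 4 (fs (fs f0)) = 1
offset 5 f0 = 1
offset 5 (fs f0) = 0
offset 5 (fs (fs f0)) = 2
offset (suc (suc (suc (suc (suc (suc e)))))) a = offset e a

offset-suc : ∀ e a → offset e a + offset e (inc a) ≡ offset (suc e) a + 1
offset-suc 0 f0 = refl
offset-suc 0 (fs f0) = refl
offset-suc 0 (fs (fs f0)) = refl
offset-suc 1 f0 = refl
offset-suc 1 (fs f0) = refl
offset-suc 1 (fs (fs f0)) = refl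
offset-suc 2 f0 = refl
offset-suc 2 (fs f0) = refl
offset-suc 2 (fs (fs f0)) = refl
offset-suc 3 f0 = refl
offset-suc 3 (fs f0) = refl
offset-suc 3 (fs (fs f0)) = refl
offset-suc 4 f0 = refl
offset-suc 4 (fs f0) = refl
offset-suc 4 (fs (fs f0)) = refl
offset-suc 5 f0 = refl
offset-suc 5 (fs f0) = refl
offset-suc 5 (fs (fs f0)) = refl
offset-suc (suc (suc (suc (suc (suc (suc e)))))) a = offset-suc e a

DS-σ^ : ∀ e a → DS (σ^ e (a ∷ [])) + 1 ≡ 2 ^ e + offset e a
DS-σ^ zero a = trans (+-comm (toℕ a + 0) 1) (cong suc (+-identityʳ (toℕ a)))
DS-σ^ (suc e) a = +-cancelʳ-≡ 1 _ _ (begin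
  DS (σ^ (suc e) (a ∷ [])) + 1 + 1                      ≡⟨ cong (λ w → DS w + 1 + 1) (σ^-suc e a) ⟩
  DS (x ++ y) + 1 + 1                                   ≡⟨ cong (λ s → s + 1 + 1) (DS-++ x y) ⟩
  DS x + DS y + 1 + 1                                   ≡⟨ rearrange (DS x) (DS y) ⟩
  (DS x + 1) + (DS y + 1)                               ≡⟨ cong₂ _+_ (DS-σ^ e a) (DS-σ^ e (inc a)) ⟩
  (2 ^ e + offset e a) + (2 ^ e + offset e (inc a))     ≡⟨ regroup (2 ^ e) (offset e a) (offset e (inc a)) ⟩
  (2 ^ e + 2 ^ e) + (offset e a + offset e (inc a))     ≡⟨ cong₂ _+_ (cong (2 ^ e +_) (sym (+-identityʳ (2 ^ e)))) (offset-suc e a) ⟩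
  2 ^ suc e + (offset (suc e) a + 1)                    ≡⟨ sym (+-assoc (2 ^ suc e) (offset (suc e) a) 1) ⟩
  2 ^ suc e + offset (suc e) a + 1                      ∎)
  where
  open ≡-Reasoning
  x = σ^ e (a ∷ [])
  y = σ^ e (inc a ∷ [])
  rearrange : ∀ p q → p + q + 1 + 1 ≡ (p + 1) + (q + 1)
  rearrange = solve-∀
  regroup : ∀ p q r → (p + q) + (p + r) ≡ (p + p) + (q + r)
  regroup = solve-∀

d-residue : ℕ → Letter
d-residue 0 = l2
d-residue 1 = l1
d-residue 2 = l1
d-residue 3 = l0
d-residue 4 = l0
d-residue _ = l2

d≡d-residue : ∀ k → d k ≡ d-residue (k % 6)
d≡d-residue k with k % 6
... | 0 = refl
... | 1 = refl
... | 2 = refl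
... | 3 = refl
... | 4 = refl
... | suc (suc (suc (suc (suc _)))) = refl

d-period : ∀ e → d (6 + e) ≡ d e
d-period e = trans (d≡d-residue (6 + e)) (sym (d≡d-residue e))

offset-d : ∀ e → offset e (d e) ≡ 2
offset-d 0 = refl
offset-d 1 = refl
offset-d 2 = refl
offset-d 3 = refl
offset-d 4 = refl
offset-d 5 = refl
offset-d (suc (suc (suc (suc (suc (suc e)))))) = trans (cong (offset e) (d-period e)) (offset-d e)

DS-block : ∀ e → DS (σ^ e (d e ∷ [])) ≡ length (σ^ e (d e ∷ [])) + 1
DS-block e = +-cancelʳ-≡ 1 _ _ (begin
  DS (σ^ e (d e ∷ [])) + 1                ≡⟨ DS-σ^ e (d e) ⟩
  2 ^ e + offset e (d e)                  ≡⟨ cong₂ _+_ (sym (length-σ^ e (d e))) (offset-d e) ⟩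
  length (σ^ e (d e ∷ [])) + 2            ≡⟨ sym (+-assoc (length (σ^ e (d e ∷ []))) 1 1) ⟩
  length (σ^ e (d e ∷ [])) + 1 + 1        ∎)
  where open ≡-Reasoning

-- d_k ≡ 2 - ⌈k/2⌉ (mod 3), stated separately for even and odd k
d-spec : ∀ i → d (2 * i) ⊕ c i ≡ l2 × d (suc (2 * i)) ⊕ c (suc i) ≡ l2
d-spec 0 = refl , refl
d-spec 1 = refl , refl
d-spec 2 = refl , refl
d-spec (suc (suc (suc i))) with d-spec i
... | even-spec , odd-spec =
  trans (cong₂ _⊕_ (trans (cong d (twice i)) (d-period (2 * i))) (inc³ (c i))) even-spec ,
  trans (cong₂ _⊕_ (trans (cong d (cong suc (twice i))) (d-period (suc (2 * i)))) (inc³ (c (suc i)))) odd-spec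
  where
  twice : ∀ i → 2 * (3 + i) ≡ 6 + 2 * i
  twice = solve-∀

ascending : (ℕ → Word) → ℕ → Word
ascending g L = concat (map g (upTo L))

descending : (ℕ → Word) → ℕ → Word
descending g R = concat (reverse (map g (upTo R)))

ascending-suc : ∀ g L → ascending g (suc L) ≡ ascending g L ++ g L
ascending-suc g L = begin
  concat (map g (upTo (suc L)))               ≡⟨ cong (concat ∘ map g) (sym (upTo-∷ʳ L)) ⟩
  concat (map g (upTo L ++ (L ∷ [])))         ≡⟨ cong concat (map-++ g (upTo L) (L ∷ [])) ⟩
  concat (map g (upTo L) ++ (g L ∷ []))       ≡⟨ sym (concat-++ (map g (upTo L)) (g L ∷ [])) ⟩
  ascending g L ++ (g L ++ [])                ≡⟨ cong (ascending g L ++_) (++-identityʳ (g L)) ⟩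
  ascending g L ++ g L                        ∎
  where open ≡-Reasoning

descending-suc : ∀ g R → descending g (suc R) ≡ g R ++ descending g R
descending-suc g R = begin
  concat (reverse (map g (upTo (suc R))))         ≡⟨ cong (concat ∘ reverse ∘ map g) (sym (upTo-∷ʳ R)) ⟩
  concat (reverse (map g (upTo R ++ (R ∷ []))))   ≡⟨ cong (concat ∘ reverse) (map-++ g (upTo R) (R ∷ [])) ⟩
  concat (reverse (map g (upTo R) ++ (g R ∷ []))) ≡⟨ cong concat (reverse-++ (map g (upTo R)) (g R ∷ [])) ⟩
  g R ++ descending g R                           ∎
  where open ≡-Reasoning

sumBelow : (ℕ → ℕ) → ℕ → ℕ
sumBelow f zero = 0
sumBelow f (suc n) = sumBelow f n + f n

sumBelow-cong : ∀ {f g} → (∀ i → f i ≡ g i) → ∀ n → sumBelow f n ≡ sumBelow g n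
sumBelow-cong f≗g zero = refl
sumBelow-cong f≗g (suc n) = cong₂ _+_ (sumBelow-cong f≗g n) (f≗g n)

sumBelow-front : ∀ f n → sumBelow f (suc n) ≡ f 0 + sumBelow (f ∘ suc) n
sumBelow-front f zero = +-comm 0 (f 0)
sumBelow-front f (suc n) = trans (cong (_+ f (suc n)) (sumBelow-front f n)) (+-assoc (f 0) _ (f (suc n)))

sumBelow-*ˡ : ∀ a f n → sumBelow (λ i → a * f i) n ≡ a * sumBelow f n
sumBelow-*ˡ a f zero = sym (*-zeroʳ a)
sumBelow-*ˡ a f (suc n) = trans (cong (_+ a * f n) (sumBelow-*ˡ a f n)) (sym (*-distribˡ-+ a (sumBelow f n) (f n)))

sumBelow-parity : ∀ h K → sumBelow h K ≡ sumBelow (λ i → h (2 * i)) ⌈ K /2⌉ + sumBelow (λ i → h (suc (2 * i))) ⌊ K /2⌋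
sumBelow-parity h zero = refl
sumBelow-parity h (suc K) = begin
  sumBelow h (suc K)                                            ≡⟨ sumBelow-front h K ⟩
  h 0 + sumBelow (h ∘ suc) K                                    ≡⟨ cong (h 0 +_) (sumBelow-parity (h ∘ suc) K) ⟩
  h 0 + (sumBelow odds ⌈ K /2⌉ + sumBelow (λ i → h (2 + 2 * i)) ⌊ K /2⌋)
      ≡⟨ cong (λ x → h 0 + (sumBelow odds ⌈ K /2⌉ + x)) (sumBelow-cong (λ i → cong h (sym (*-suc 2 i))) ⌊ K /2⌋) ⟩
  h 0 + (sumBelow odds ⌈ K /2⌉ + sumBelow (evens ∘ suc) ⌊ K /2⌋) ≡⟨ regroup (h 0) (sumBelow odds ⌈ K /2⌉) _ ⟩
  (h 0 + sumBelow (evens ∘ suc) ⌊ K /2⌋) + sumBelow odds ⌈ K /2⌉ ≡⟨ cong (_+ sumBelow odds ⌈ K /2⌉) (sym (sumBelow-front evens ⌊ K /2⌋)) ⟩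
  sumBelow evens (suc ⌊ K /2⌋) + sumBelow odds ⌈ K /2⌉         ∎
  where
  open ≡-Reasoning
  evens odds : ℕ → ℕ
  evens i = h (2 * i)
  odds i = h (suc (2 * i))
  regroup : ∀ a b c → a + (b + c) ≡ (a + c) + b
  regroup = solve-∀

length-ascending : ∀ g L → length (ascending g L) ≡ sumBelow (length ∘ g) L
length-ascending g zero = refl
length-ascending g (suc L) = begin
  length (ascending g (suc L))        ≡⟨ cong length (ascending-suc g L) ⟩
  length (ascending g L ++ g L)       ≡⟨ length-++ (ascending g L) ⟩
  length (ascending g L) + length (g L) ≡⟨ cong (_+ length (g L)) (length-ascending g L) ⟩
  sumBelow (length ∘ g) (suc L)       ∎
  where open ≡-Reasoning

length-descending : ∀ g R → length (descending g R) ≡ sumBelow (length ∘ g) R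
length-descending g zero = refl
length-descending g (suc R) = begin
  length (descending g (suc R))         ≡⟨ cong length (descending-suc g R) ⟩
  length (g R ++ descending g R)        ≡⟨ length-++ (g R) ⟩
  length (g R) + length (descending g R) ≡⟨ +-comm (length (g R)) _ ⟩
  length (descending g R) + length (g R) ≡⟨ cong (_+ length (g R)) (length-descending g R) ⟩
  sumBelow (length ∘ g) (suc R)         ∎
  where open ≡-Reasoning

HeavyBlocks : (ℕ → Word) → Set
HeavyBlocks g = ∀ i → DS (g i) ≡ length (g i) + 1

DS-ascending : ∀ g → HeavyBlocks g → ∀ L → DS (ascending g L) ≡ length (ascending g L) + L
DS-ascending g heavy zero = refl
DS-ascending g heavy (suc L) = begin
  DS (ascending g (suc L))                    ≡⟨ cong DS (ascending-suc g L) ⟩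
  DS (ascending g L ++ g L)                   ≡⟨ DS-++ (ascending g L) (g L) ⟩
  DS (ascending g L) + DS (g L)               ≡⟨ cong₂ _+_ (DS-ascending g heavy L) (heavy L) ⟩
  (length (ascending g L) + L) + (length (g L) + 1) ≡⟨ shuffle (length (ascending g L)) L (length (g L)) ⟩
  (length (ascending g L) + length (g L)) + suc L   ≡⟨ cong (_+ suc L) (sym (length-++ (ascending g L))) ⟩
  length (ascending g L ++ g L) + suc L       ≡⟨ cong (λ w → length w + suc L) (sym (ascending-suc g L)) ⟩
  length (ascending g (suc L)) + suc L        ∎
  where
  open ≡-Reasoning
  shuffle : ∀ a l b → (a + l) + (b + 1) ≡ (a + b) + suc l
  shuffle = solve-∀

DS-descending : ∀ g → HeavyBlocks g → ∀ R → DS (descending g R) ≡ length (descending g R) + R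
DS-descending g heavy zero = refl
DS-descending g heavy (suc R) = begin
  DS (descending g (suc R))                   ≡⟨ cong DS (descending-suc g R) ⟩
  DS (g R ++ descending g R)                  ≡⟨ DS-++ (g R) (descending g R) ⟩
  DS (g R) + DS (descending g R)              ≡⟨ cong₂ _+_ (heavy R) (DS-descending g heavy R) ⟩
  (length (g R) + 1) + (length (descending g R) + R) ≡⟨ shuffle (length (g R)) (length (descending g R)) R ⟩
  (length (g R) + length (descending g R)) + suc R   ≡⟨ cong (_+ suc R) (sym (length-++ (g R))) ⟩
  length (g R ++ descending g R) + suc R      ≡⟨ cong (λ w → length w + suc R) (sym (descending-suc g R)) ⟩
  length (descending g (suc R)) + suc R       ∎
  where
  open ≡-Reasoning
  shuffle : ∀ b a r → (b + 1) + (a + r) ≡ (b + a) + suc r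
  shuffle = solve-∀

⊕-c-+ : ∀ x a b → x ⊕ c a ⊕ c b ≡ x ⊕ c (a + b)
⊕-c-+ x a b = trans (⊕-assoc x (c a) (c b)) (cong (x ⊕_) (sym (c-+ a b)))

t-onto : ∀ a → ∃ λ Z → t Z ≡ a
t-onto f0 = 0 , refl
t-onto (fs f0) = 1 , refl
t-onto (fs (fs f0)) = 3 , refl

-- If v + 2i + b ≡ i + 1 then v + 1 = d_{2i+b}: the letter opening a left block.
left-letter : ∀ i b v → b ≤ 1 → v ⊕ c (2 * i + b) ≡ c (suc i) → inc v ≡ d (2 * i + b)
left-letter i b v b≤1 hyp = ⊕-cancelʳ (c (i + b)) (trans (⊕-cancelʳ (c i) (begin
  inc v ⊕ c (i + b) ⊕ c i        ≡⟨ cong (_⊕ c i) (trans (inc-⊕ v (c (i + b))) (sym (⊕-inc v (c (i + b))))) ⟩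
  v ⊕ c (suc (i + b)) ⊕ c i      ≡⟨ ⊕-c-+ v (suc (i + b)) i ⟩
  v ⊕ c (suc (i + b) + i)        ≡⟨ cong (λ z → v ⊕ c z) (regroup i b) ⟩
  v ⊕ c (2 * i + b + 1)          ≡⟨ sym (⊕-c-+ v (2 * i + b) 1) ⟩
  v ⊕ c (2 * i + b) ⊕ c 1        ≡⟨ cong (_⊕ c 1) hyp ⟩
  c (suc i) ⊕ c 1                ≡⟨ sym (c-+ (suc i) 1) ⟩
  c (suc i + 1)                  ≡⟨ cong c (+-comm (suc i) 1) ⟩
  c (2 + i)                      ≡⟨ c-+ 2 i ⟩
  l2 ⊕ c i                       ∎)) (sym (spec b b≤1)))
  where
  open ≡-Reasoning
  regroup : ∀ i b → suc (i + b) + i ≡ 2 * i + b + 1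
  regroup = solve-∀
  spec : ∀ b → b ≤ 1 → d (2 * i + b) ⊕ c (i + b) ≡ l2
  spec zero _ = subst₂ (λ k j → d k ⊕ c j ≡ l2) (sym (+-identityʳ (2 * i))) (sym (+-identityʳ i)) (proj₁ (d-spec i))
  spec (suc zero) _ = subst₂ (λ k j → d k ⊕ c j ≡ l2) (+-comm 1 (2 * i)) (+-comm 1 i) (proj₂ (d-spec i))
  spec (suc (suc _)) (s≤s ())

-- If q + R + 1 ≡ 2 then q = d_{2R+1+b}: the letter opening a right block.
right-letter : ∀ R b q → b ≤ 1 → q ⊕ c (suc R) ≡ l2 → q ≡ d (suc (2 * R) + b)
right-letter R zero q _ hyp =
  ⊕-cancelʳ (c (suc R)) (trans hyp (sym (subst (λ k → d k ⊕ c (suc R) ≡ l2) (sym (+-identityʳ (suc (2 * R)))) (proj₂ (d-spec R)))))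
right-letter R (suc zero) q _ hyp =
  ⊕-cancelʳ (c (suc R)) (trans hyp (sym (subst (λ k → d k ⊕ c (suc R) ≡ l2) (sym (odd+1 R)) (proj₁ (d-spec (suc R))))))
  where
  odd+1 : ∀ R → suc (2 * R) + 1 ≡ 2 * suc R
  odd+1 = solve-∀
right-letter R (suc (suc _)) q (s≤s ()) hyp

-- the position with binary expansion V·0·1^h, that is (2V+1)·2^h - 1
padOnes : ℕ → ℕ → ℕ
padOnes V zero = 2 * V
padOnes V (suc h) = suc (2 * padOnes V h)

suc-padOnes : ∀ V h → suc (padOnes V h) ≡ suc (2 * V) * 2 ^ h
suc-padOnes V zero = sym (*-identityʳ _)
suc-padOnes V (suc h) = begin
  suc (suc (2 * padOnes V h))   ≡⟨ sym (*-suc 2 (padOnes V h)) ⟩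
  2 * suc (padOnes V h)         ≡⟨ cong (2 *_) (suc-padOnes V h) ⟩
  2 * (suc (2 * V) * 2 ^ h)     ≡⟨ swap (suc (2 * V)) (2 ^ h) ⟩
  suc (2 * V) * 2 ^ suc h       ∎
  where
  open ≡-Reasoning
  swap : ∀ a x → 2 * (a * x) ≡ a * (2 * x)
  swap = solve-∀

suc-padOnes-* : ∀ V h a → suc (padOnes V h) * 2 ^ a ≡ suc (2 * V) * 2 ^ (h + a)
suc-padOnes-* V h a = begin
  suc (padOnes V h) * 2 ^ a           ≡⟨ cong (_* 2 ^ a) (suc-padOnes V h) ⟩
  suc (2 * V) * 2 ^ h * 2 ^ a         ≡⟨ *-assoc (suc (2 * V)) (2 ^ h) (2 ^ a) ⟩
  suc (2 * V) * (2 ^ h * 2 ^ a)       ≡⟨ cong (suc (2 * V) *_) (sym (^-distribˡ-+-* 2 h a)) ⟩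
  suc (2 * V) * 2 ^ (h + a)           ∎
  where open ≡-Reasoning

t-padOnes : ∀ V h → t (padOnes V h) ≡ t V ⊕ c h
t-padOnes V zero = t-even V
t-padOnes V (suc h) = trans (t-odd (padOnes V h)) (trans (cong inc (t-padOnes V h)) (sym (⊕-inc (t V) (c h))))

OccursBefore : Word → ℕ → Set
OccursBefore w X = ∃ λ P → P + length w ≡ X × OccursAt w P

occursBefore-++ : ∀ {v w X} → OccursBefore v X → OccursAt w X → OccursBefore (v ++ w) (X + length w)
occursBefore-++ {v} {w} (P , end , occV) occW =
  P , trans (cong (P +_) (length-++ v)) (trans (sym (+-assoc P (length v) (length w))) (cong (_+ length w) end)) ,
  occurs-++ occV (subst (OccursAt w) (sym end) occW)

occursBefore⇒factor : ∀ {w X} → OccursBefore w X → FactorOfT w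
occursBefore⇒factor (P , _ , occ) = occurs⇒factor P occ

t-4V+2 : ∀ V → t V ≡ l0 → t (2 * suc (2 * V)) ≡ l1
t-4V+2 V tV = trans (t-even (suc (2 * V))) (trans (t-odd V) (cong inc tV))

t-4V+3 : ∀ V → t V ≡ l0 → t (suc (2 * suc (2 * V))) ≡ l2
t-4V+3 V tV = trans (t-odd (suc (2 * V))) (cong inc (trans (t-odd V) (cong inc tV)))

OptionalOne : Word → Set
OptionalOne δw = δw ≡ [] ⊎ δw ≡ l1 ∷ []

module Construction (digit : ℕ → ℕ) (digit≤1 : ∀ j → digit j ≤ 1) where

  block : ℕ → Word
  block e = σ^ e (d e ∷ [])

  eL fR : ℕ → ℕ
  eL i = 2 * i + digit (2 * i)
  fR i = 2 * i ∸ 1 + digit (2 * i ∸ 1)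

  left-block right-block : ℕ → Word
  left-block i = block (eL (suc i))
  right-block i = block (fR (suc i))

  W-left : Word → ℕ → Word
  W-left δw L = δw ++ (l2 ∷ ascending left-block L)

  W-right : ℕ → Word
  W-right R = descending right-block R ++ (l2 ∷ [])

  W-left-suc : ∀ δw L → W-left δw (suc L) ≡ W-left δw L ++ left-block L
  W-left-suc δw L = trans (cong (λ z → δw ++ (l2 ∷ z)) (ascending-suc left-block L))
                          (sym (++-assoc δw (l2 ∷ ascending left-block L) (left-block L)))

  W-right-suc : ∀ R → W-right (suc R) ≡ right-block R ++ W-right R
  W-right-suc R = trans (cong (_++ (l2 ∷ [])) (descending-suc right-block R))
                        (++-assoc (right-block R) (descending right-block R) (l2 ∷ []))

  -- W-left δw L is placed so that it ends at a multiple of 2^(lastExp L + 1)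
  lastExp : ℕ → ℕ
  lastExp zero = 1
  lastExp (suc L) = eL (suc L)

  lastExp-increasing : ∀ L → lastExp L < lastExp (suc L)
  lastExp-increasing zero = s≤s (s≤s z≤n)
  lastExp-increasing (suc L) = begin-strict
    2 * suc L + digit (2 * suc L)    ≤⟨ +-monoʳ-≤ (2 * suc L) (digit≤1 (2 * suc L)) ⟩
    2 * suc L + 1                    <⟨ +-monoʳ-< (2 * suc L) (n<1+n 1) ⟩
    2 * suc L + 2                    ≡⟨ next L ⟩
    2 * suc (suc L)                  ≤⟨ m≤m+n (2 * suc (suc L)) (digit (2 * suc (suc L))) ⟩
    eL (suc (suc L))                 ∎
    where
    open ≤-Reasoning
    next : ∀ L → 2 * suc L + 2 ≡ 2 * suc (suc L)
    next = solve-∀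

  -- W-right R is placed at a multiple of 2^X for any X ≥ firstBound R
  firstBound : ℕ → ℕ
  firstBound zero = 0
  firstBound (suc R) = suc (fR (suc R))

  fR-suc : ∀ R → fR (suc R) ≡ suc (2 * R) + digit (suc (2 * R))
  fR-suc R = cong (λ z → z + digit z) (+-suc R (R + 0))

  firstBound-≤ : ∀ R → firstBound R ≤ fR (suc R)
  firstBound-≤ zero = z≤n
  firstBound-≤ (suc R) rewrite fR-suc R | fR-suc (suc R) = begin
    suc (suc (2 * R) + digit (suc (2 * R)))  ≤⟨ s≤s (+-monoʳ-≤ (suc (2 * R)) (digit≤1 _)) ⟩
    suc (suc (2 * R) + 1)                    ≡⟨ next R ⟩
    suc (2 * suc R)                          ≤⟨ m≤m+n (suc (2 * suc R)) _ ⟩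
    suc (2 * suc R) + digit (suc (2 * suc R)) ∎
    where
    open ≤-Reasoning
    next : ∀ R → suc (suc (2 * R) + 1) ≡ suc (2 * suc R)
    next = solve-∀

  right-occurs : ∀ R Q X → firstBound R ≤ X → t Q ⊕ c R ≡ l2 → OccursAt (W-right R) (Q * 2 ^ X)
  right-occurs zero Q X _ tQ = cong (_∷ []) (trans (t-*2^ Q X) tQ)
  right-occurs (suc R) Q X bound tQ =
    subst (λ w → OccursAt w (Q * 2 ^ X)) (sym (W-right-suc R))
      (subst (OccursAt _) (sym Q2^X) (occurs-++ first rest))
    where
    f = fR (suc R)
    Q₂ = Q * 2 ^ (X ∸ suc f)
    Q2^X : Q * 2 ^ X ≡ 2 * Q₂ * 2 ^ f
    Q2^X = begin
      Q * 2 ^ X                         ≡⟨ cong (λ z → Q * 2 ^ z) (sym (m∸n+n≡m bound)) ⟩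
      Q * 2 ^ (X ∸ suc f + suc f)       ≡⟨ cong (Q *_) (^-distribˡ-+-* 2 (X ∸ suc f) (suc f)) ⟩
      Q * (2 ^ (X ∸ suc f) * 2 ^ suc f) ≡⟨ regroup Q (2 ^ (X ∸ suc f)) (2 ^ f) ⟩
      2 * Q₂ * 2 ^ f                    ∎
      where
      open ≡-Reasoning
      regroup : ∀ q y x → q * (y * (2 * x)) ≡ 2 * (q * y) * x
      regroup = solve-∀
    tQ₂ : t Q₂ ≡ t Q
    tQ₂ = t-*2^ Q (X ∸ suc f)
    first : OccursAt (right-block R) (2 * Q₂ * 2 ^ f)
    first = subst (λ a → OccursAt (σ^ f (a ∷ [])) (2 * Q₂ * 2 ^ f))
      (trans (trans (t-even Q₂) tQ₂) (trans (right-letter R (digit (suc (2 * R))) (t Q) (digit≤1 _) tQ) (cong d (sym (fR-suc R)))))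
      (block-occurs f (2 * Q₂))
    rest : OccursAt (W-right R) (2 * Q₂ * 2 ^ f + length (right-block R))
    rest = subst (OccursAt (W-right R))
      (trans (+-comm (2 ^ f) (2 * Q₂ * 2 ^ f)) (cong (2 * Q₂ * 2 ^ f +_) (sym (length-σ^ f (d f)))))
      (right-occurs R (suc (2 * Q₂)) f (firstBound-≤ R)
        (trans (cong (_⊕ c R) (trans (t-odd Q₂) (cong inc tQ₂))) (trans (inc-⊕ (t Q) (c R)) (trans (sym (⊕-inc (t Q) (c R))) tQ))))

  left-occurs : ∀ δw → OptionalOne δw → ∀ L V → t V ⊕ c (lastExp L) ≡ c (suc L) →
                OccursBefore (W-left δw L) (suc V * 2 ^ suc (lastExp L))
  left-occurs .[] (inj₁ refl) zero V tV =
    suc (2 * suc (2 * V)) , end V , cong (_∷ []) (t-4V+3 V (⊕-cancelʳ (c 1) tV))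
    where
    end : ∀ V → suc (2 * suc (2 * V)) + 1 ≡ suc V * 2 ^ 2
    end = solve-∀
  left-occurs .(l1 ∷ []) (inj₂ refl) zero V tV =
    2 * suc (2 * V) , end V , cong₂ (λ a b → a ∷ b ∷ []) (t-4V+2 V tV≡0) (t-4V+3 V tV≡0)
    where
    tV≡0 = ⊕-cancelʳ (c 1) tV
    end : ∀ V → 2 * suc (2 * V) + 2 ≡ suc V * 2 ^ 2
    end = solve-∀
  left-occurs δw opt (suc L) V tV =
    subst₂ OccursBefore (sym (W-left-suc δw L)) end (occursBefore-++ (subst (OccursBefore (W-left δw L)) join prefix) B)
    where
    E = lastExp L
    e = lastExp (suc L)
    h = e ∸ suc E
    E+h : E + suc h ≡ e
    E+h = trans (+-suc E h) (m+[n∸m]≡n (lastExp-increasing L))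
    V′ = padOnes V h
    tV′ : t V′ ⊕ c E ≡ c (suc L)
    tV′ = ⊕-cancelʳ (c 1) (begin
      t V′ ⊕ c E ⊕ c 1        ≡⟨ cong (λ x → x ⊕ c E ⊕ c 1) (t-padOnes V h) ⟩
      t V ⊕ c h ⊕ c E ⊕ c 1   ≡⟨ cong (_⊕ c 1) (⊕-c-+ (t V) h E) ⟩
      t V ⊕ c (h + E) ⊕ c 1   ≡⟨ ⊕-c-+ (t V) (h + E) 1 ⟩
      t V ⊕ c (h + E + 1)     ≡⟨ cong (λ z → t V ⊕ c z) (trans (regroup h E) E+h) ⟩
      t V ⊕ c e               ≡⟨ tV ⟩
      c (suc L) ⊕ c 1         ∎)
      where
      open ≡-Reasoning
      regroup : ∀ h E → h + E + 1 ≡ E + suc h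
      regroup = solve-∀
    prefix : OccursBefore (W-left δw L) (suc V′ * 2 ^ suc E)
    prefix = left-occurs δw opt L V′ tV′
    join : suc V′ * 2 ^ suc E ≡ suc (2 * V) * 2 ^ e
    join = trans (suc-padOnes-* V h (suc E))
      (cong (λ z → suc (2 * V) * 2 ^ z) (trans (+-comm h (suc E)) (trans (sym (+-suc E h)) E+h)))
    B : OccursAt (left-block L) (suc (2 * V) * 2 ^ e)
    B = subst (λ a → OccursAt (σ^ e (a ∷ [])) (suc (2 * V) * 2 ^ e))
          (trans (t-odd V) (left-letter (suc L) (digit (2 * suc L)) (t V) (digit≤1 _) tV))
          (block-occurs e (suc (2 * V)))
    end : suc (2 * V) * 2 ^ e + length (left-block L) ≡ suc V * 2 ^ suc e
    end = trans (cong (suc (2 * V) * 2 ^ e +_) (length-σ^ e (d e))) (double V (2 ^ e))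
      where
      double : ∀ V x → suc (2 * V) * x + x ≡ suc V * (2 * x)
      double = solve-∀

  W-factor : ∀ δw → OptionalOne δw → ∀ L R → FactorOfT (W-left δw L ++ W-right R)
  W-factor δw opt L R = occursBefore⇒factor (occursBefore-++ left right)
    where
    E = lastExp L
    -- W-right R will start at an odd multiple (2Z+1)·2^X with t(Z) + R ≡ 1
    Z = proj₁ (t-onto (l1 ⊕ neg (c R)))
    tZ : t Z ⊕ c R ≡ l1
    tZ = trans (cong (_⊕ c R) (proj₂ (t-onto _))) (⊕-solve (c R) l1)
    -- W-left δw L ends there if its parameter V = padOnes Z G satisfies the residue condition;
    -- G is chosen large enough to leave room for W-right R
    target = c (suc L) ⊕ neg (t Z ⊕ c E)
    G = proj₁ (c-unbounded (firstBound R) target)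
    cG : c G ≡ target
    cG = proj₂ (proj₂ (c-unbounded (firstBound R) target))
    V = padOnes Z G
    tV : t V ⊕ c E ≡ c (suc L)
    tV = begin
      t V ⊕ c E               ≡⟨ cong (_⊕ c E) (trans (t-padOnes Z G) (⊕-comm (t Z) (c G))) ⟩
      c G ⊕ t Z ⊕ c E         ≡⟨ ⊕-assoc (c G) (t Z) (c E) ⟩
      c G ⊕ (t Z ⊕ c E)       ≡⟨ cong (_⊕ (t Z ⊕ c E)) cG ⟩
      target ⊕ (t Z ⊕ c E)    ≡⟨ ⊕-solve (t Z ⊕ c E) (c (suc L)) ⟩
      c (suc L)               ∎
      where open ≡-Reasoning
    X = G + suc E
    left : OccursBefore (W-left δw L) (suc (2 * Z) * 2 ^ X)
    left = subst (OccursBefore (W-left δw L)) (suc-padOnes-* Z G (suc E)) (left-occurs δw opt L V tV)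
    right : OccursAt (W-right R) (suc (2 * Z) * 2 ^ X)
    right = right-occurs R (suc (2 * Z)) X (≤-trans (proj₁ (proj₂ (c-unbounded (firstBound R) target))) (m≤m+n G (suc E)))
      (trans (cong (_⊕ c R) (t-odd Z)) (trans (inc-⊕ (t Z) (c R)) (cong inc tZ)))

  -- Digit sum: each block and each of the two letters 2 contributes one more than its
  -- length, while δ contributes exactly its length.

  DS-W-left : ∀ δw → DS δw ≡ length δw → ∀ L → DS (W-left δw L) ≡ length (W-left δw L) + suc L
  DS-W-left δw DSδ L = begin
    DS (δw ++ (l2 ∷ A))            ≡⟨ DS-++ δw (l2 ∷ A) ⟩
    DS δw + (2 + DS A)             ≡⟨ cong₂ (λ x y → x + (2 + y)) DSδ (DS-ascending left-block (λ i → DS-block (eL (suc i))) L) ⟩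
    length δw + (2 + (length A + L)) ≡⟨ regroup (length δw) (length A) L ⟩
    (length δw + suc (length A)) + suc L ≡⟨ cong (_+ suc L) (sym (length-++ δw)) ⟩
    length (δw ++ (l2 ∷ A)) + suc L ∎
    where
    open ≡-Reasoning
    A = ascending left-block L
    regroup : ∀ x a l → x + (2 + (a + l)) ≡ (x + suc a) + suc l
    regroup = solve-∀

  DS-W-right : ∀ R → DS (W-right R) ≡ length (W-right R) + suc R
  DS-W-right R = begin
    DS (D ++ (l2 ∷ []))            ≡⟨ DS-++ D (l2 ∷ []) ⟩
    DS D + 2                       ≡⟨ cong (_+ 2) (DS-descending right-block (λ i → DS-block (fR (suc i))) R) ⟩
    length D + R + 2               ≡⟨ regroup (length D) R ⟩
    (length D + 1) + suc R         ≡⟨ cong (_+ suc R) (sym (length-++ D)) ⟩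
    length (D ++ (l2 ∷ [])) + suc R ∎
    where
    open ≡-Reasoning
    D = descending right-block R
    regroup : ∀ x r → x + r + 2 ≡ (x + 1) + suc r
    regroup = solve-∀

  DS-W : ∀ δw → DS δw ≡ length δw → ∀ L R →
         DS (W-left δw L ++ W-right R) ≡ length (W-left δw L ++ W-right R) + (L + R + 2)
  DS-W δw DSδ L R = begin
    DS (v ++ w)                              ≡⟨ DS-++ v w ⟩
    DS v + DS w                              ≡⟨ cong₂ _+_ (DS-W-left δw DSδ L) (DS-W-right R) ⟩
    (length v + suc L) + (length w + suc R)  ≡⟨ regroup (length v) (length w) L R ⟩
    (length v + length w) + (L + R + 2)      ≡⟨ cong (_+ (L + R + 2)) (sym (length-++ v)) ⟩
    length (v ++ w) + (L + R + 2)            ∎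
    where
    open ≡-Reasoning
    v = W-left δw L
    w = W-right R
    regroup : ∀ x y l r → (x + suc l) + (y + suc r) ≡ (x + y) + (l + r + 2)
    regroup = solve-∀

  weight : ℕ → ℕ
  weight j = 2 ^ (j + digit j)

  length-W : ∀ δw L R → length (W-left δw L ++ W-right R) ≡
             length δw + suc (sumBelow (λ i → weight (2 * suc i)) L) + (sumBelow (λ i → weight (2 * suc i ∸ 1)) R + 1)
  length-W δw L R = begin
    length (v ++ w)          ≡⟨ length-++ v ⟩
    length v + length w      ≡⟨ cong₂ _+_ (length-++ δw) (length-++ (descending right-block R)) ⟩
    length δw + suc (length (ascending left-block L)) + (length (descending right-block R) + 1)
        ≡⟨ cong₂ (λ x y → length δw + suc x + (y + 1))
                 (trans (length-ascending left-block L) (sumBelow-cong (λ i → length-σ^ (eL (suc i)) _) L))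
                 (trans (length-descending right-block R) (sumBelow-cong (λ i → length-σ^ (fR (suc i)) _) R)) ⟩
    length δw + suc (sumBelow (λ i → weight (2 * suc i)) L) + (sumBelow (λ i → weight (2 * suc i ∸ 1)) R + 1) ∎
    where
    open ≡-Reasoning
    v = W-left δw L
    w = W-right R

  weight-split : ∀ j → weight j ≡ 2 ^ j + digit j * 2 ^ j
  weight-split j with digit j | digit≤1 j
  ... | zero | _ = trans (cong (2 ^_) (+-identityʳ j)) (sym (+-identityʳ (2 ^ j)))
  ... | suc zero | _ = cong (2 ^_) (+-comm j 1)
  ... | suc (suc _) | s≤s ()

  weights-sum : ∀ K → 2 + sumBelow (weight ∘ suc) K + digit 0 ≡ 2 ^ suc K + sumBelow (λ j → digit j * 2 ^ j) (suc K)
  weights-sum zero = cong (2 +_) (sym (*-identityʳ (digit 0)))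
  weights-sum (suc K) = begin
    2 + (S + weight (suc K)) + digit 0                ≡⟨ cong (λ w → 2 + (S + w) + digit 0) (weight-split (suc K)) ⟩
    2 + (S + (p + digit (suc K) * p)) + digit 0       ≡⟨ regroup₁ S (digit 0) p (digit (suc K) * p) ⟩
    (2 + S + digit 0) + p + digit (suc K) * p         ≡⟨ cong (λ z → z + p + digit (suc K) * p) (weights-sum K) ⟩
    (p + B) + p + digit (suc K) * p                   ≡⟨ regroup₂ p B (digit (suc K) * p) ⟩
    (p + (p + 0)) + (B + digit (suc K) * p)           ∎
    where
    open ≡-Reasoning
    S = sumBelow (weight ∘ suc) K
    B = sumBelow (λ j → digit j * 2 ^ j) (suc K)
    p = 2 ^ suc K
    regroup₁ : ∀ s m p y → 2 + (s + (p + y)) + m ≡ (2 + s + m) + p + y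
    regroup₁ = solve-∀
    regroup₂ : ∀ p b y → (p + b) + p + y ≡ (p + (p + 0)) + (b + y)
    regroup₂ = solve-∀

  length-W-balanced : ∀ δw → length δw ≡ digit 0 → ∀ K →
    length (W-left δw ⌊ K /2⌋ ++ W-right ⌈ K /2⌉) ≡ 2 ^ suc K + sumBelow (λ j → digit j * 2 ^ j) (suc K)
  length-W-balanced δw lenδ K = begin
    length (W-left δw ⌊ K /2⌋ ++ W-right ⌈ K /2⌉)              ≡⟨ length-W δw ⌊ K /2⌋ ⌈ K /2⌉ ⟩
    length δw + suc (Lsum ⌊ K /2⌋) + (Rsum ⌈ K /2⌉ + 1)         ≡⟨ regroup (length δw) (Lsum ⌊ K /2⌋) (Rsum ⌈ K /2⌉) ⟩
    2 + (Rsum ⌈ K /2⌉ + Lsum ⌊ K /2⌋) + length δw               ≡⟨ cong₂ (λ x y → 2 + x + y) (sym split) lenδ ⟩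
    2 + sumBelow (weight ∘ suc) K + digit 0                     ≡⟨ weights-sum K ⟩
    2 ^ suc K + sumBelow (λ j → digit j * 2 ^ j) (suc K)        ∎
    where
    open ≡-Reasoning
    Lsum Rsum : ℕ → ℕ
    Lsum = sumBelow (λ i → weight (2 * suc i))
    Rsum = sumBelow (λ i → weight (2 * suc i ∸ 1))
    regroup : ∀ x l r → x + suc l + (r + 1) ≡ 2 + (r + l) + x
    regroup = solve-∀
    split : sumBelow (weight ∘ suc) K ≡ Rsum ⌈ K /2⌉ + Lsum ⌊ K /2⌋
    split = trans (sumBelow-parity (weight ∘ suc) K)
      (cong₂ _+_ (sumBelow-cong (λ i → cong weight (sym (+-suc i (i + 0)))) ⌈ K /2⌉)
                 (sumBelow-cong (λ i → cong weight (sym (*-suc 2 i))) ⌊ K /2⌋))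

  DS-W-balanced : ∀ δw → DS δw ≡ length δw → ∀ K →
    DS (W-left δw ⌊ K /2⌋ ++ W-right ⌈ K /2⌉) ≡ length (W-left δw ⌊ K /2⌋ ++ W-right ⌈ K /2⌉) + (K + 2)
  DS-W-balanced δw DSδ K = trans (DS-W δw DSδ ⌊ K /2⌋ ⌈ K /2⌉)
    (cong (λ z → length (W-left δw ⌊ K /2⌋ ++ W-right ⌈ K /2⌉) + (z + 2)) (⌊n/2⌋+⌈n/2⌉≡n K))

half-decomposition : ∀ x → x % 2 + 2 * ⌊ x /2⌋ ≡ x
half-decomposition zero = refl
half-decomposition (suc zero) = refl
half-decomposition (suc (suc x)) = begin
  x % 2 + 2 * suc ⌊ x /2⌋        ≡⟨ cong (x % 2 +_) (*-suc 2 ⌊ x /2⌋) ⟩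
  x % 2 + (2 + 2 * ⌊ x /2⌋)      ≡⟨ +-comm (x % 2) (2 + 2 * ⌊ x /2⌋) ⟩
  2 + (2 * ⌊ x /2⌋ + x % 2)      ≡⟨ cong (2 +_) (+-comm (2 * ⌊ x /2⌋) (x % 2)) ⟩
  2 + (x % 2 + 2 * ⌊ x /2⌋)      ≡⟨ cong (2 +_) (half-decomposition x) ⟩
  suc (suc x)                    ∎
  where open ≡-Reasoning

⌊/2⌋-< : ∀ k x → x < 2 ^ suc k → ⌊ x /2⌋ < 2 ^ k
⌊/2⌋-< k x x< = *-cancelˡ-< 2 ⌊ x /2⌋ (2 ^ k)
  (≤-<-trans (≤-trans (m≤n+m (2 * ⌊ x /2⌋) (x % 2)) (≤-reflexive (half-decomposition x))) x<)

⌊2*/2⌋ : ∀ x → ⌊ 2 * x /2⌋ ≡ x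
⌊2*/2⌋ zero = refl
⌊2*/2⌋ (suc x) = trans (cong ⌊_/2⌋ (*-suc 2 x)) (cong suc (⌊2*/2⌋ x))

bit≤1 : ∀ j x → bit j x ≤ 1
bit≤1 j x = ≤-pred (m%n<n (shiftR j x) 2)

bits-value : ∀ k x → x < 2 ^ k → sumBelow (λ j → bit j x * 2 ^ j) k ≡ x
bits-value zero zero _ = refl
bits-value zero (suc x) (s≤s ())
bits-value (suc k) x x< = begin
  sumBelow (λ j → bit j x * 2 ^ j) (suc k)                    ≡⟨ sumBelow-front (λ j → bit j x * 2 ^ j) k ⟩
  x % 2 * 1 + sumBelow (λ j → bit j ⌊ x /2⌋ * (2 * 2 ^ j)) k  ≡⟨ cong₂ _+_ (*-identityʳ (x % 2)) (sumBelow-cong (λ j → swap (bit j ⌊ x /2⌋) (2 ^ j)) k) ⟩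
  x % 2 + sumBelow (λ j → 2 * (bit j ⌊ x /2⌋ * 2 ^ j)) k      ≡⟨ cong (x % 2 +_) (sumBelow-*ˡ 2 (λ j → bit j ⌊ x /2⌋ * 2 ^ j) k) ⟩
  x % 2 + 2 * sumBelow (λ j → bit j ⌊ x /2⌋ * 2 ^ j) k        ≡⟨ cong (λ z → x % 2 + 2 * z) (bits-value k ⌊ x /2⌋ (⌊/2⌋-< k x x<)) ⟩
  x % 2 + 2 * ⌊ x /2⌋                                         ≡⟨ half-decomposition x ⟩
  x                                                           ∎
  where
  open ≡-Reasoning
  swap : ∀ b p → b * (2 * p) ≡ 2 * (b * p)
  swap = solve-∀

2^-increasing : ∀ k → 2 ^ k < 2 ^ suc k
2^-increasing k = m<m+n (2 ^ k) (<-≤-trans (m^n>0 2 k) (m≤m+n (2 ^ k) 0))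

log₂-exists : ∀ n → 1 ≤ n → ∃ λ k → 2 ^ k ≤ n × n < 2 ^ suc k
log₂-exists (suc zero) _ = 0 , ≤-refl , s≤s (s≤s z≤n)
log₂-exists (suc (suc n)) _ with log₂-exists (suc n) (s≤s z≤n)
... | k , lo , hi with m≤n⇒m<n∨m≡n hi
...   | inj₁ below = k , m≤n⇒m≤1+n lo , below
...   | inj₂ top = suc k , ≤-reflexive (sym top) ,
                   subst (_< 2 ^ suc (suc k)) (sym top) (2^-increasing (suc k))

⌊log₂⌋-unique : ∀ k n → 2 ^ k ≤ n → n < 2 ^ suc k → ⌊log₂ n ⌋ ≡ k
⌊log₂⌋-unique zero (suc zero) _ _ = refl
⌊log₂⌋-unique zero (suc (suc n)) _ (s≤s (s≤s ()))
⌊log₂⌋-unique (suc k) n lo hi = begin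
  ⌊log₂ n ⌋                 ≡⟨ sym (m∸n+n≡m log≥1) ⟩
  ⌊log₂ n ⌋ ∸ 1 + 1         ≡⟨ +-comm (⌊log₂ n ⌋ ∸ 1) 1 ⟩
  suc (⌊log₂ n ⌋ ∸ 1)       ≡⟨ cong suc (sym (⌊log₂⌊n/2⌋⌋≡⌊log₂n⌋∸1 n)) ⟩
  suc ⌊log₂ ⌊ n /2⌋ ⌋       ≡⟨ cong suc (⌊log₂⌋-unique k ⌊ n /2⌋ half-lo (⌊/2⌋-< (suc k) n hi)) ⟩
  suc k                     ∎
  where
  open ≡-Reasoning
  half-lo : 2 ^ k ≤ ⌊ n /2⌋
  half-lo = subst (_≤ ⌊ n /2⌋) (⌊2*/2⌋ (2 ^ k)) (⌊n/2⌋-mono lo)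
  log≥1 : 1 ≤ ⌊log₂ n ⌋
  log≥1 = subst (_≤ ⌊log₂ n ⌋) (⌊log₂[2^n]⌋≡n 1) (⌊log₂⌋-mono-≤ (≤-trans (*-monoʳ-≤ 2 (m^n>0 2 k)) lo))

log₂-bounds : ∀ n → 1 ≤ n → 2 ^ ⌊log₂ n ⌋ ≤ n × n < 2 ^ suc ⌊log₂ n ⌋
log₂-bounds n 1≤n with log₂-exists n 1≤n
... | k , lo , hi rewrite ⌊log₂⌋-unique k n lo hi = lo , hi

-- W(n) for n ≥ 2 is the construction for the binary digits of r = n - 2^k, with
-- K = k - 1 split into ⌊K/2⌋ left and ⌈K/2⌉ right blocks.

δ-facts : ∀ n → OptionalOne (δ n) × DS (δ n) ≡ length (δ n) × length (δ n) ≡ m n 0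
δ-facts n with m n 0 | bit≤1 0 (n ∸ 2 ^ kk n)
... | zero | _ = inj₁ refl , refl , refl
... | suc zero | _ = inj₂ refl , refl , refl
... | suc (suc _) | s≤s ()

W-properties : ∀ n → 2 ≤ n → FactorOfT (W n) × DS (W n) ≡ n + ⌊log₂ n ⌋ + 1 × length (W n) ≡ n
W-properties (suc zero) (s≤s ())
W-properties n@(suc (suc _)) 2≤n = W-factor (δ n) opt ⌊ K /2⌋ ⌈ K /2⌉ , DS-Wn , length-Wn
  where
  open Construction (m n) (λ j → bit≤1 j (n ∸ 2 ^ kk n))
  k = ⌊log₂ n ⌋
  K = k ∸ 1
  opt = proj₁ (δ-facts n)
  K+1≡k : suc K ≡ k
  K+1≡k = trans (+-comm 1 K) (m∸n+n≡m (subst (_≤ k) (⌊log₂[2^n]⌋≡n 1) (⌊log₂⌋-mono-≤ 2≤n)))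
  2^k≤n = proj₁ (log₂-bounds n (s≤s z≤n))
  r<2^k : n ∸ 2 ^ k < 2 ^ k
  r<2^k = +-cancelˡ-< (2 ^ k) (n ∸ 2 ^ k) (2 ^ k)
    (subst₂ _<_ (sym (m+[n∸m]≡n 2^k≤n)) (cong (2 ^ k +_) (+-identityʳ (2 ^ k))) (proj₂ (log₂-bounds n (s≤s z≤n))))
  length-Wn : length (W n) ≡ n
  length-Wn = begin
    length (W n)                                          ≡⟨ length-W-balanced (δ n) (proj₂ (proj₂ (δ-facts n))) K ⟩
    2 ^ suc K + sumBelow (λ j → m n j * 2 ^ j) (suc K)    ≡⟨ cong (λ z → 2 ^ z + sumBelow (λ j → m n j * 2 ^ j) z) K+1≡k ⟩
    2 ^ k + sumBelow (λ j → m n j * 2 ^ j) k              ≡⟨ cong (2 ^ k +_) (bits-value k (n ∸ 2 ^ k) r<2^k) ⟩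
    2 ^ k + (n ∸ 2 ^ k)                                   ≡⟨ m+[n∸m]≡n 2^k≤n ⟩
    n                                                     ∎
    where open ≡-Reasoning
  DS-Wn : DS (W n) ≡ n + k + 1
  DS-Wn = begin
    DS (W n)                   ≡⟨ DS-W-balanced (δ n) (proj₁ (proj₂ (δ-facts n))) K ⟩
    length (W n) + (K + 2)     ≡⟨ cong₂ _+_ length-Wn (trans (+-comm K 2) (cong suc K+1≡k)) ⟩
    n + suc k                  ≡⟨ sym (trans (+-assoc n k 1) (cong (n +_) (+-comm k 1))) ⟩
    n + k + 1                  ∎
    where open ≡-Reasoning

complement-arith : ∀ x n k → x + (n + k + 1) ≡ 2 * n → x ≡ n ∸ k ∸ 1
complement-arith x n k sum≡ = begin
  x                              ≡⟨ sym (m+n∸n≡m x (n + k + 1)) ⟩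
  x + (n + k + 1) ∸ (n + k + 1)  ≡⟨ cong₂ _∸_ (trans sum≡ (cong (n +_) (+-identityʳ n))) (+-assoc n k 1) ⟩
  n + n ∸ (n + (k + 1))          ≡⟨ [m+n]∸[m+o]≡n∸o n n (k + 1) ⟩
  n ∸ (k + 1)                    ≡⟨ sym (∸-+-assoc n k 1) ⟩
  n ∸ k ∸ 1                      ∎
  where open ≡-Reasoning

proposition2 : (n : ℕ) → 1 ≤ n →
    FactorOfT (W n) × FactorOfT (mirror (τ₁ (W n))) ×
    DS (W n) ≡ n + ⌊log₂ n ⌋ + 1 × DS (mirror (τ₁ (W n))) ≡ n ∸ ⌊log₂ n ⌋ ∸ 1
proposition2 (suc zero) _ = (3 , refl) , (0 , refl) , refl , refl
proposition2 n@(suc (suc _)) _ = factor , mirror-factor (W n) factor , DS-W≡ , DS-mirror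
  where
  properties = W-properties n (s≤s (s≤s z≤n))
  factor = proj₁ properties
  DS-W≡ = proj₁ (proj₂ properties)
  DS-mirror : DS (mirror (τ₁ (W n))) ≡ n ∸ ⌊log₂ n ⌋ ∸ 1
  DS-mirror = complement-arith _ n ⌊log₂ n ⌋ (begin
    DS (mirror (τ₁ (W n))) + (n + ⌊log₂ n ⌋ + 1)  ≡⟨ cong (DS (mirror (τ₁ (W n))) +_) (sym DS-W≡) ⟩
    DS (mirror (τ₁ (W n))) + DS (W n)             ≡⟨ DS-mirror-τ₁ (W n) ⟩
    2 * length (W n)                              ≡⟨ cong (2 *_) (proj₂ (proj₂ properties)) ⟩
    2 * n                                         ∎)
    where open ≡-Reasoning
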